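{- For any graph $G=(V,E)$ with $V\neq\emptyset$, the domination polynomial satisfies \[D_G(x)=\sum_{J\subseteq V}(-1)^{|J|}(x+1)^{|V|-|N_G[J]|}=\sum_{\substack{J\subseteq V\\|J|\le|V|-\delta(G)}}(-1)^{|J|}\Big[(x+1)^{|V|-|N_G[J]|}-1\Big].\] Moreover, if $G$ has no isolated vertices, then for any linear ordering of $V$ and any set $\mathscr{X}$ of broken neighbourhoods of $G$, both sums above remain valid when restricted to those $J\subseteq V$ that contain no $X\in\mathscr{X}$ as a subset.
   Context: All graphs are finite, undirected and simple. $D_G(x)=\sum_{k=0}^{|V|}d_k(G)x^k$ where $d_k(G)$ is the number of dominating sets of $G$ of size $k$ (a set $S$ is dominating if every vertex outside $S$ is adjacent to a vertex of $S$). $N_G[J]$ is the closed neighbourhood of $J$ (vertices in $J$ or adjacent to a vertex of $J$), $N_G[v]=N_G[\{v\}]$. $\delta(G)$ is the minimum degree. Given a linear ordering of $V$, a broken neighbourhood of $G$ is a set $N_G[v]\setminus\{v\}$ for a vertex $v$ with $v=\max N_G[v]$. -}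

module Defs where

open import Level using (Level)
open import Data.Bool using (Bool; true; false; _∧_; _∨_; not; if_then_else_)
open import Data.Nat using (ℕ; zero; suc; _∸_; _⊓_; _≡ᵇ_; _<_; _≤ᵇ_)
open import Data.Fin using (Fin; toℕ)
open import Data.Fin.Subset using (Subset; ∣_∣; _∈_; _⊆_)
open import Data.Fin.Subset.Properties using (_⊆?_)
open import Data.Vec using (Vec; []; _∷_; tabulate)
open import Data.List using (List; []; _∷_; _++_; map; filter; length; foldr; allFin)
open import Data.List.Relation.Unary.Any using (Any)
open import Data.Product using (Σ; ∃; _×_)
open import Relation.Binary.PropositionalEquality using (_≡_)
open import Relation.Nullary.Decidable using (⌊_⌋)
open import Algebra.Bundles using (CommutativeRing)
open import Function.Definitions using (Injective)

record Graph (n : ℕ) : Set where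
  field
    adj   : Fin n → Fin n → Bool
    sym   : ∀ u v → adj u v ≡ adj v u
    irrefl : ∀ v → adj v v ≡ false
open Graph public

anyV : ∀ {n} → (Fin n → Bool) → Bool
anyV {n} p = foldr (λ v b → p v ∨ b) false (allFin n)

allV : ∀ {n} → (Fin n → Bool) → Bool
allV {n} p = foldr (λ v b → p v ∧ b) true (allFin n)

allSubsets : (n : ℕ) → List (Subset n)
allSubsets zero = [] ∷ []
allSubsets (suc n) = map (false ∷_) (allSubsets n) ++ map (true ∷_) (allSubsets n)

mem : ∀ {n} → Fin n → Subset n → Bool
mem v S = Data.Vec.lookup S v

isDominating : ∀ {n} → Graph n → Subset n → Bool
isDominating G S = allV (λ v → mem v S ∨ anyV (λ u → mem u S ∧ adj G u v))

domCount : ∀ {n} → Graph n → ℕ → ℕ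
domCount {n} G k = length (filter (λ S → isDominating G S ∧ (∣ S ∣ ≡ᵇ k) Data.Bool.≟ true) (allSubsets n))

closedNbhd : ∀ {n} → Graph n → Subset n → Subset n
closedNbhd G J = tabulate (λ v → mem v J ∨ anyV (λ u → mem u J ∧ adj G u v))

-- open neighbourhood N_G[v] \ {v}  (= N_G(v), as the graph is loopless)
openNbhd : ∀ {n} → Graph n → Fin n → Subset n
openNbhd G v = tabulate (λ u → adj G v u)

degree : ∀ {n} → Graph n → Fin n → ℕ
degree G v = ∣ openNbhd G v ∣

minDegree : ∀ {m} → Graph (suc m) → ℕ
minDegree {m} G = foldr (λ v d → degree G v ⊓ d) (degree G Data.Fin.zero) (allFin (suc m))

NoIsolated : ∀ {n} → Graph n → Set
NoIsolated {n} G = ∀ (v : Fin n) → ∃ λ u → adj G v u ≡ true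

-- A linear ordering of V is given by an injective rank function
-- r : Fin n → Fin n  (u precedes v iff toℕ (r u) < toℕ (r v)).
LinearOrder : ℕ → Set
LinearOrder n = Σ (Fin n → Fin n) Injective'
  where Injective' : (Fin n → Fin n) → Set
        Injective' r = Injective _≡_ _≡_ r

IsMaxOfClosedNbhd : ∀ {n} → Graph n → LinearOrder n → Fin n → Set
IsMaxOfClosedNbhd {n} G (r Data.Product., _) v =
  ∀ (u : Fin n) → u ∈ (closedNbhd G (tabulate (λ w → ⌊ w Data.Fin.≟ v ⌋))) → toℕ (r u) Data.Nat.≤ toℕ (r v)

IsBrokenNbhd : ∀ {n} → Graph n → LinearOrder n → Subset n → Set
IsBrokenNbhd G ord X = ∃ λ v → IsMaxOfClosedNbhd G ord v × X ≡ openNbhd G v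

avoids : ∀ {n} → List (Subset n) → Subset n → Bool
avoids 𝒳 J = foldr (λ X b → not ⌊ X ⊆? J ⌋ ∧ b) true 𝒳

module InRing {c ℓ : Level} (R : CommutativeRing c ℓ) where
  open CommutativeRing R hiding (zero)

  pow : Carrier → ℕ → Carrier
  pow x zero = 1#
  pow x (suc k) = x * pow x k

  nat : ℕ → Carrier
  nat zero = 0#
  nat (suc k) = 1# + nat k

  sumL : ∀ {A : Set} → (A → Carrier) → List A → Carrier
  sumL f xs = foldr (λ a s → f a + s) 0# xs

  sumTo : ℕ → (ℕ → Carrier) → Carrier
  sumTo zero f = f zero
  sumTo (suc N) f = sumTo N f + f (suc N)

  domPoly : ∀ {n} → Graph n → Carrier → Carrier
  domPoly {n} G x = sumTo n (λ k → nat (domCount G k) * pow x k)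

  term₁ : ∀ {n} → Graph n → Carrier → Subset n → Carrier
  term₁ {n} G x J = pow (- 1#) ∣ J ∣ * pow (x + 1#) (n ∸ ∣ closedNbhd G J ∣)

  term₂ : ∀ {n} → Graph n → Carrier → Subset n → Carrier
  term₂ {n} G x J = pow (- 1#) ∣ J ∣ * (pow (x + 1#) (n ∸ ∣ closedNbhd G J ∣) - 1#)

  sumSubsets : (n : ℕ) → (Subset n → Bool) → (Subset n → Carrier) → Carrier
  sumSubsets n P f = sumL f (filter (λ J → P J Data.Bool.≟ true) (allSubsets n))

module Submission where

-- Expand (x+1)^{|V| - |N[J]|} = Σ_{S ∩ N[J] = ∅} x^|S| and exchange the two sums. Since S misses N[J]
-- exactly when J misses N[S], the inner sum becomes Σ_{J ⊆ V ∖ N[S]} (-1)^|J| = 0^{|V ∖ N[S]|},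
-- which is 1 for dominating S and 0 otherwise. The second form differs from the first by
-- Σ_J (-1)^|J| = 0, and its summands vanish once |J| > |V| - δ, because then N[J] = V.
-- For a broken neighbourhood X = N(v), toggling v is a sign-reversing involution on the sets
-- containing X that fixes N[J], so these sets contribute nothing and may be dropped.

open import Defs
open import Level using (Level)
open import Data.Bool using (Bool; true; false; T; not; _∧_; _∨_; if_then_else_)
open import Data.Bool.Properties using (T-∧; T-∨; T-≡)
open import Data.Nat using (ℕ; zero; suc; _∸_; _≤_; _<_; _≡ᵇ_; _≤ᵇ_; _⊓_)
import Data.Nat.Properties as ℕ
import Data.Fin as Fin
open import Data.Fin using (Fin)
open import Data.Fin.Properties using (toℕ-injective)
open import Data.Fin.Subset using (Subset; inside; outside; _∈_; _∉_; _⊆_; _⊂_; ∁; ∣_∣; Empty)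
open import Data.Fin.Subset.Properties
  using (_⊆?_; ⊆-antisym; ∣p∣≤n; Empty-unique; ∣⊥∣≡0; ∣∁p∣≡n∸∣p∣; p⊂q⇒∣p∣<∣q∣; x∈∁p⇒x∉p; x∉∁p⇒x∈p; x∉p⇒x∈∁p)
open import Data.Vec using ([]; _∷_; there; tabulate; _[_]≔_)
open import Data.Vec.Properties
  using (lookup∘tabulate; []=⇒lookup; lookup⇒[]=; []≔-updates; []≔-minimal; []≔-idempotent)
open import Data.List using (List; []; _∷_; _++_; map; filter; length; foldr; allFin)
open import Data.List.Membership.Propositional using () renaming (_∈_ to _∈ₗ_)
open import Data.List.Membership.Propositional.Properties using (∈-allFin)
open import Data.List.Relation.Unary.Any using (here; there)
open import Data.List.Relation.Unary.All using (All; []; _∷_)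
open import Data.Product using (∃; _×_; _,_; proj₁; proj₂)
open import Data.Sum using (_⊎_; inj₁; inj₂)
open import Function using (_∘_; mk⇔; Equivalence)
open import Relation.Binary.PropositionalEquality as ≡ using (_≡_; _≢_; refl)
open import Relation.Nullary using (¬_; contradiction; does; yes; no)
open import Relation.Nullary.Decidable using (⌊_⌋; T?; does-⇔; isYes≗does; fromWitness; toWitness)
open import Algebra.Bundles using (CommutativeRing)

module _ {n : ℕ} (p : Fin n → Bool) where

  anyV⁺ : ∀ v → T (p v) → T (anyV p)
  anyV⁺ v pv = go (allFin n) (∈-allFin v)
    where
      go : ∀ vs → v ∈ₗ vs → T (foldr (λ u b → p u ∨ b) false vs)
      go (u ∷ vs) (here refl) = Equivalence.from T-∨ (inj₁ pv)
      go (u ∷ vs) (there v∈vs) = Equivalence.from T-∨ (inj₂ (go vs v∈vs))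

  anyV⁻ : T (anyV p) → ∃ λ v → T (p v)
  anyV⁻ = go (allFin n)
    where
      go : ∀ vs → T (foldr (λ u b → p u ∨ b) false vs) → ∃ λ v → T (p v)
      go (u ∷ vs) t with Equivalence.to T-∨ t
      ... | inj₁ pu = u , pu
      ... | inj₂ rest = go vs rest

  allV⁺ : (∀ v → T (p v)) → T (allV p)
  allV⁺ all = go (allFin n)
    where
      go : ∀ vs → T (foldr (λ u b → p u ∧ b) true vs)
      go [] = _
      go (u ∷ vs) = Equivalence.from T-∧ (all u , go vs)

  allV⁻ : T (allV p) → ∀ v → T (p v)
  allV⁻ t v = go (allFin n) (∈-allFin v) t
    where
      go : ∀ vs → v ∈ₗ vs → T (foldr (λ u b → p u ∧ b) true vs) → T (p v)
      go (u ∷ vs) (here refl) t = proj₁ (Equivalence.to T-∧ t)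
      go (u ∷ vs) (there v∈vs) t = go vs v∈vs (proj₂ (Equivalence.to T-∧ t))

module _ {n : ℕ} where

  ∈⇒T-mem : ∀ {x} {p : Subset n} → x ∈ p → T (mem x p)
  ∈⇒T-mem x∈p = Equivalence.from T-≡ ([]=⇒lookup x∈p)

  T-mem⇒∈ : ∀ {x} {p : Subset n} → T (mem x p) → x ∈ p
  T-mem⇒∈ {x} {p} t = lookup⇒[]= x p (Equivalence.to T-≡ t)

  ∈-tabulate⁺ : ∀ (f : Fin n → Bool) {x} → T (f x) → x ∈ tabulate f
  ∈-tabulate⁺ f {x} t = T-mem⇒∈ (≡.subst T (≡.sym (lookup∘tabulate f x)) t)

  ∈-tabulate⁻ : ∀ (f : Fin n → Bool) {x} → x ∈ tabulate f → T (f x)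
  ∈-tabulate⁻ f {x} x∈ = ≡.subst T (lookup∘tabulate f x) (∈⇒T-mem x∈)

  Empty⇒∣p∣≡0 : ∀ {p : Subset n} → Empty p → ∣ p ∣ ≡ 0
  Empty⇒∣p∣≡0 empty = ≡.trans (≡.cong ∣_∣ (Empty-unique empty)) (∣⊥∣≡0 n)

  module _ {S : Subset n} {v : Fin n} where

    ∉-[]≔outside : v ∉ S [ v ]≔ outside
    ∉-[]≔outside v∈ with ≡.trans (≡.sym ([]=⇒lookup ([]≔-updates S v))) ([]=⇒lookup v∈)
    ... | ()

    ∈-[]≔-retoggle : ∀ {u b b′} → u ≢ v → u ∈ S [ v ]≔ b → u ∈ S [ v ]≔ b′
    ∈-[]≔-retoggle {u} {b} u≢v u∈ = ≡.subst (u ∈_) ([]≔-idempotent S v) ([]≔-minimal (S [ v ]≔ b) u v u≢v u∈)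

    ⊆-[]≔-retoggle : ∀ {X b b′} → v ∉ X → X ⊆ S [ v ]≔ b → X ⊆ S [ v ]≔ b′
    ⊆-[]≔-retoggle v∉X X⊆ u∈X = ∈-[]≔-retoggle (λ { refl → v∉X u∈X }) (X⊆ u∈X)

    ⌊⊆?⌋-[]≔ : ∀ {X b b′} → v ∉ X → ⌊ X ⊆? S [ v ]≔ b ⌋ ≡ ⌊ X ⊆? S [ v ]≔ b′ ⌋
    ⌊⊆?⌋-[]≔ {X} {b} {b′} v∉X = begin
      ⌊ X ⊆? S [ v ]≔ b ⌋     ≡⟨ isYes≗does (X ⊆? _) ⟩
      does (X ⊆? S [ v ]≔ b)  ≡⟨ does-⇔ (mk⇔ (⊆-[]≔-retoggle v∉X) (⊆-[]≔-retoggle v∉X)) (X ⊆? _) (X ⊆? _) ⟩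
      does (X ⊆? S [ v ]≔ b′) ≡⟨ isYes≗does (X ⊆? _) ⟨
      ⌊ X ⊆? S [ v ]≔ b′ ⌋    ∎
      where open ≡.≡-Reasoning

∣p∣≡0⇒x∉p : ∀ {n} {p : Subset n} {x} → ∣ p ∣ ≡ 0 → x ∉ p
∣p∣≡0⇒x∉p {p = outside ∷ p} ∣p∣≡0 (there x∈p) = ∣p∣≡0⇒x∉p ∣p∣≡0 x∈p

∣[]≔inside∣ : ∀ {n} (S : Subset n) v → ∣ S [ v ]≔ inside ∣ ≡ suc ∣ S [ v ]≔ outside ∣
∣[]≔inside∣ (_ ∷ S) Fin.zero = refl
∣[]≔inside∣ (inside ∷ S) (Fin.suc v) = ≡.cong suc (∣[]≔inside∣ S v)
∣[]≔inside∣ (outside ∷ S) (Fin.suc v) = ∣[]≔inside∣ S v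

module Sums {c ℓ : Level} (R : CommutativeRing c ℓ) where
  open CommutativeRing R renaming (refl to ≈-refl; sym to ≈-sym; trans to ≈-trans)
    hiding (zero)
  open InRing R
  open import Algebra.Properties.Ring ring using (-1*x≈-x)
  open import Algebra.Properties.CommutativeSemigroup +-commutativeSemigroup using (interchange)
  open import Relation.Binary.Reasoning.Setoid setoid

  [_]·_ : Bool → Carrier → Carrier
  [ b ]· a = if b then a else 0#

  []·-cong : ∀ b {a a′} → a ≈ a′ → [ b ]· a ≈ [ b ]· a′
  []·-cong true a≈a′ = a≈a′
  []·-cong false _ = ≈-refl

  []·-false : ∀ {b} a → ¬ T b → [ b ]· a ≈ 0#
  []·-false {true} a ¬b = contradiction _ ¬b
  []·-false {false} a _ = ≈-refl

  []·-absorb : ∀ {b} a → (¬ T b → a ≈ 0#) → [ b ]· a ≈ a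
  []·-absorb {true} a _ = ≈-refl
  []·-absorb {false} a a≈0 = ≈-sym (a≈0 λ ())

  []·-∧-absorb : ∀ {b} b′ a → (¬ T b → a ≈ 0#) → [ b ∧ b′ ]· a ≈ [ b′ ]· a
  []·-∧-absorb {true} b′ a _ = ≈-refl
  []·-∧-absorb {false} true a a≈0 = ≈-sym (a≈0 λ ())
  []·-∧-absorb {false} false a _ = ≈-refl

  *-[]· : ∀ a b a′ → a * ([ b ]· a′) ≈ [ b ]· (a * a′)
  *-[]· a true a′ = ≈-refl
  *-[]· a false a′ = zeroʳ a

  []·-* : ∀ b a a′ → ([ b ]· a) * a′ ≈ [ b ]· (a * a′)
  []·-* true a a′ = ≈-refl
  []·-* false a a′ = zeroˡ a′

  []·-split : ∀ b b′ a → [ not b ∧ b′ ]· a + [ b ∧ b′ ]· a ≈ [ b′ ]· a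
  []·-split true b′ a = +-identityˡ _
  []·-split false b′ a = +-identityʳ _

  []·-cancel : ∀ {b b′ a a′} → b ≡ b′ → (T b → a + a′ ≈ 0#) → [ b ]· a + [ b′ ]· a′ ≈ 0#
  []·-cancel {true} refl a+a′≈0 = a+a′≈0 _
  []·-cancel {false} refl _ = +-identityˡ 0#

  x+-1*x≈0 : ∀ a → a + - 1# * a ≈ 0#
  x+-1*x≈0 a = ≈-trans (+-congˡ (-1*x≈-x a)) (-‿inverseʳ a)

  sumL-cong : ∀ {A : Set} {f g : A → Carrier} xs → (∀ a → f a ≈ g a) → sumL f xs ≈ sumL g xs
  sumL-cong [] _ = ≈-refl
  sumL-cong (a ∷ xs) f≈g = +-cong (f≈g a) (sumL-cong xs f≈g)

  sumL-zero : ∀ {A : Set} xs → sumL {A} (λ _ → 0#) xs ≈ 0#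
  sumL-zero [] = ≈-refl
  sumL-zero (a ∷ xs) = ≈-trans (+-identityˡ _) (sumL-zero xs)

  sumL-+ : ∀ {A : Set} (f g : A → Carrier) xs → sumL (λ a → f a + g a) xs ≈ sumL f xs + sumL g xs
  sumL-+ f g [] = ≈-sym (+-identityˡ 0#)
  sumL-+ f g (a ∷ xs) = ≈-trans (+-congˡ (sumL-+ f g xs)) (interchange (f a) (g a) (sumL f xs) (sumL g xs))

  *-distribˡ-sumL : ∀ {A : Set} k (f : A → Carrier) xs → k * sumL f xs ≈ sumL (λ a → k * f a) xs
  *-distribˡ-sumL k f [] = zeroʳ k
  *-distribˡ-sumL k f (a ∷ xs) = ≈-trans (distribˡ k (f a) (sumL f xs)) (+-congˡ (*-distribˡ-sumL k f xs))

  *-distribʳ-sumL : ∀ {A : Set} k (f : A → Carrier) xs → sumL f xs * k ≈ sumL (λ a → f a * k) xs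
  *-distribʳ-sumL k f [] = zeroˡ k
  *-distribʳ-sumL k f (a ∷ xs) = ≈-trans (distribʳ k (f a) (sumL f xs)) (+-congˡ (*-distribʳ-sumL k f xs))

  sumL-++ : ∀ {A : Set} (f : A → Carrier) xs ys → sumL f (xs ++ ys) ≈ sumL f xs + sumL f ys
  sumL-++ f [] ys = ≈-sym (+-identityˡ _)
  sumL-++ f (a ∷ xs) ys = ≈-trans (+-congˡ (sumL-++ f xs ys)) (≈-sym (+-assoc _ _ _))

  sumL-map : ∀ {A B : Set} (f : B → Carrier) (g : A → B) xs → sumL f (map g xs) ≈ sumL (f ∘ g) xs
  sumL-map f g [] = ≈-refl
  sumL-map f g (a ∷ xs) = +-congˡ (sumL-map f g xs)

  sumL-filter : ∀ {A : Set} (p : A → Bool) (f : A → Carrier) xs →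
                sumL f (filter (λ a → p a Data.Bool.≟ true) xs) ≈ sumL (λ a → [ p a ]· f a) xs
  sumL-filter p f [] = ≈-refl
  sumL-filter p f (a ∷ xs) with p a
  ... | true = +-congˡ (sumL-filter p f xs)
  ... | false = ≈-trans (sumL-filter p f xs) (≈-sym (+-identityˡ _))

  nat-length-filter : ∀ {A : Set} (p : A → Bool) y xs →
                      nat (length (filter (λ a → p a Data.Bool.≟ true) xs)) * y ≈ sumL (λ a → [ p a ]· y) xs
  nat-length-filter p y [] = zeroˡ y
  nat-length-filter p y (a ∷ xs) with p a
  ... | true = ≈-trans (distribʳ y 1# _) (+-cong (*-identityˡ y) (nat-length-filter p y xs))
  ... | false = ≈-trans (nat-length-filter p y xs) (≈-sym (+-identityˡ _))

  sumL-swap : ∀ {A B : Set} (F : A → B → Carrier) xs ys →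
              sumL (λ a → sumL (F a) ys) xs ≈ sumL (λ b → sumL (λ a → F a b) xs) ys
  sumL-swap F [] ys = ≈-sym (sumL-zero ys)
  sumL-swap F (a ∷ xs) ys = ≈-trans (+-congˡ (sumL-swap F xs ys)) (≈-sym (sumL-+ (F a) _ ys))

  sumTo-sumL : ∀ {A : Set} N (F : ℕ → A → Carrier) xs →
               sumTo N (λ k → sumL (F k) xs) ≈ sumL (λ a → sumTo N (λ k → F k a)) xs
  sumTo-sumL zero F xs = ≈-refl
  sumTo-sumL (suc N) F xs = ≈-trans (+-congʳ (sumTo-sumL N F xs)) (≈-sym (sumL-+ _ (F (suc N)) xs))

  sumTo-cong : ∀ N {f g : ℕ → Carrier} → (∀ k → f k ≈ g k) → sumTo N f ≈ sumTo N g
  sumTo-cong zero f≈g = f≈g zero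
  sumTo-cong (suc N) f≈g = +-cong (sumTo-cong N f≈g) (f≈g (suc N))

  sumTo-zero : ∀ N → sumTo N (λ _ → 0#) ≈ 0#
  sumTo-zero zero = ≈-refl
  sumTo-zero (suc N) = ≈-trans (+-identityʳ _) (sumTo-zero N)

  sumTo-vanish : ∀ N a (f : ℕ → Carrier) → N < a → sumTo N (λ k → [ a ≡ᵇ k ]· f k) ≈ 0#
  sumTo-vanish zero a f N<a = []·-false (f 0) (ℕ.<⇒≢ N<a ∘ ≡.sym ∘ ℕ.≡ᵇ⇒≡ a 0)
  sumTo-vanish (suc N) a f N<a =
    ≈-trans (+-cong (sumTo-vanish N a f (ℕ.<-trans (ℕ.n<1+n N) N<a))
                    ([]·-false (f (suc N)) (ℕ.<⇒≢ N<a ∘ ≡.sym ∘ ℕ.≡ᵇ⇒≡ a (suc N))))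
            (+-identityʳ 0#)

  sumTo-select : ∀ N a (f : ℕ → Carrier) → a ≤ N → sumTo N (λ k → [ a ≡ᵇ k ]· f k) ≈ f a
  sumTo-select zero zero f _ = ≈-refl
  sumTo-select (suc N) a f a≤1+N with ℕ.m≤n⇒m<n∨m≡n a≤1+N
  ... | inj₁ a<1+N = ≈-trans (+-cong (sumTo-select N a f (ℕ.≤-pred a<1+N))
                                     ([]·-false (f (suc N)) (ℕ.<⇒≢ a<1+N ∘ ℕ.≡ᵇ⇒≡ a (suc N))))
                             (+-identityʳ (f a))
  ... | inj₂ refl = ≈-trans (+-congʳ (sumTo-vanish N (suc N) f (ℕ.n<1+n N)))
                            (≈-trans (+-identityˡ _) ([]·-absorb (f (suc N)) (contradiction (ℕ.≡⇒≡ᵇ N N refl))))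

  ∑ : ∀ n → (Subset n → Carrier) → Carrier
  ∑ n f = sumL f (allSubsets n)

  ∑-cong : ∀ n {f g : Subset n → Carrier} → (∀ S → f S ≈ g S) → ∑ n f ≈ ∑ n g
  ∑-cong n = sumL-cong (allSubsets n)

  ∑-suc : ∀ n (f : Subset (suc n) → Carrier) → ∑ (suc n) f ≈ ∑ n (f ∘ (outside ∷_)) + ∑ n (f ∘ (inside ∷_))
  ∑-suc n f = ≈-trans (sumL-++ f (map (outside ∷_) (allSubsets n)) (map (inside ∷_) (allSubsets n)))
                      (+-cong (sumL-map f (outside ∷_) (allSubsets n)) (sumL-map f (inside ∷_) (allSubsets n)))

  binomial : ∀ n z (T : Subset n) → pow (z + 1#) ∣ T ∣ ≈ ∑ n λ S → [ does (S ⊆? T) ]· pow z ∣ S ∣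
  binomial zero z [] = ≈-sym (+-identityʳ 1#)
  binomial (suc n) z (outside ∷ T) = begin
    pow (z + 1#) ∣ T ∣                                            ≈⟨ binomial n z T ⟩
    ∑ n (λ S → [ does (S ⊆? T) ]· pow z ∣ S ∣)                    ≈⟨ +-identityʳ _ ⟨
    ∑ n (λ S → [ does (S ⊆? T) ]· pow z ∣ S ∣) + 0#               ≈⟨ +-congˡ (sumL-zero (allSubsets n)) ⟨
    ∑ n (λ S → [ does (S ⊆? T) ]· pow z ∣ S ∣) + ∑ n (λ _ → 0#)   ≈⟨ ∑-suc n _ ⟨
    ∑ (suc n) (λ S → [ does (S ⊆? outside ∷ T) ]· pow z ∣ S ∣)    ∎
  binomial (suc n) z (inside ∷ T) = begin
    (z + 1#) * pow (z + 1#) ∣ T ∣          ≈⟨ *-congˡ (binomial n z T) ⟩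
    (z + 1#) * B                           ≈⟨ distribʳ B z 1# ⟩
    z * B + 1# * B                         ≈⟨ +-comm _ _ ⟩
    1# * B + z * B                         ≈⟨ +-cong (*-identityˡ B) (*-distribˡ-sumL z _ (allSubsets n)) ⟩
    B + ∑ n (λ S → z * [ does (S ⊆? T) ]· pow z ∣ S ∣)
                                           ≈⟨ +-congˡ (∑-cong n λ S → *-[]· z (does (S ⊆? T)) _) ⟩
    B + ∑ n (λ S → [ does (S ⊆? T) ]· (z * pow z ∣ S ∣))
                                           ≈⟨ ∑-suc n _ ⟨
    ∑ (suc n) (λ S → [ does (S ⊆? inside ∷ T) ]· pow z ∣ S ∣) ∎
    where B = ∑ n λ S → [ does (S ⊆? T) ]· pow z ∣ S ∣

  toggle-cancel : ∀ n v (f : Subset n → Carrier) →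
                  (∀ S → f (S [ v ]≔ outside) + f (S [ v ]≔ inside) ≈ 0#) → ∑ n f ≈ 0#
  toggle-cancel (suc n) Fin.zero f cancels = begin
    ∑ (suc n) f                                          ≈⟨ ∑-suc n f ⟩
    ∑ n (f ∘ (outside ∷_)) + ∑ n (f ∘ (inside ∷_))       ≈⟨ sumL-+ _ _ (allSubsets n) ⟨
    ∑ n (λ S → f (outside ∷ S) + f (inside ∷ S))         ≈⟨ ∑-cong n (λ S → cancels (outside ∷ S)) ⟩
    ∑ n (λ _ → 0#)                                       ≈⟨ sumL-zero (allSubsets n) ⟩
    0#                                                   ∎
  toggle-cancel (suc n) (Fin.suc v) f cancels = begin
    ∑ (suc n) f                                          ≈⟨ ∑-suc n f ⟩
    ∑ n (f ∘ (outside ∷_)) + ∑ n (f ∘ (inside ∷_))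
      ≈⟨ +-cong (toggle-cancel n v _ (cancels ∘ (outside ∷_))) (toggle-cancel n v _ (cancels ∘ (inside ∷_))) ⟩
    0# + 0#                                              ≈⟨ +-identityˡ 0# ⟩
    0#                                                   ∎

  alternating-sum : ∀ m → ∑ (suc m) (λ J → pow (- 1#) ∣ J ∣) ≈ 0#
  alternating-sum m = toggle-cancel (suc m) Fin.zero _ λ { (_ ∷ S) → x+-1*x≈0 (pow (- 1#) ∣ S ∣) }

  pow-0 : ∀ k → pow (- 1# + 1#) k ≈ [ k ≡ᵇ 0 ]· 1#
  pow-0 zero = ≈-refl
  pow-0 (suc k) = ≈-trans (*-congʳ (-‿inverseˡ 1#)) (zeroˡ _)

module Neighbourhoods {n : ℕ} (G : Graph n) where

  infix 4 _∼_
  _∼_ : Fin n → Fin n → Set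
  u ∼ w = u ≡ w ⊎ T (adj G u w)

  private
    inClosedNbhd : Subset n → Fin n → Bool
    inClosedNbhd J w = mem w J ∨ anyV (λ u → mem u J ∧ adj G u w)

  ∼-sym : ∀ {u w} → u ∼ w → w ∼ u
  ∼-sym (inj₁ refl) = inj₁ refl
  ∼-sym {u} {w} (inj₂ u-w) = inj₂ (≡.subst T (sym G u w) u-w)

  ∈-closedNbhd⁺ : ∀ {J u w} → u ∈ J → u ∼ w → w ∈ closedNbhd G J
  ∈-closedNbhd⁺ {J} u∈J (inj₁ refl) =
    ∈-tabulate⁺ (inClosedNbhd J) (Equivalence.from T-∨ (inj₁ (∈⇒T-mem u∈J)))
  ∈-closedNbhd⁺ {J} {u} u∈J (inj₂ u-w) =
    ∈-tabulate⁺ (inClosedNbhd J)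
      (Equivalence.from T-∨ (inj₂ (anyV⁺ _ u (Equivalence.from T-∧ (∈⇒T-mem u∈J , u-w)))))

  ∈-closedNbhd⁻ : ∀ {J w} → w ∈ closedNbhd G J → ∃ λ u → u ∈ J × u ∼ w
  ∈-closedNbhd⁻ {J} {w} w∈N with Equivalence.to T-∨ (∈-tabulate⁻ (inClosedNbhd J) w∈N)
  ... | inj₁ w∈J = w , T-mem⇒∈ w∈J , inj₁ refl
  ... | inj₂ ∃u with anyV⁻ _ ∃u
  ...   | u , u∈J∧u-w = let (u∈J , u-w) = Equivalence.to T-∧ u∈J∧u-w in u , T-mem⇒∈ u∈J , inj₂ u-w

  ∈-openNbhd⁺ : ∀ {v u} → T (adj G v u) → u ∈ openNbhd G v
  ∈-openNbhd⁺ = ∈-tabulate⁺ _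

  ∈-openNbhd⁻ : ∀ {v u} → u ∈ openNbhd G v → T (adj G v u)
  ∈-openNbhd⁻ = ∈-tabulate⁻ _

  ∉-openNbhd : ∀ {v} → v ∉ openNbhd G v
  ∉-openNbhd {v} v∈ = ≡.subst T (irrefl G v) (∈-openNbhd⁻ v∈)

  ⊆∁closedNbhd-sym : ∀ {S J} → S ⊆ ∁ (closedNbhd G J) → J ⊆ ∁ (closedNbhd G S)
  ⊆∁closedNbhd-sym S⊆ v∈J = x∉p⇒x∈∁p λ v∈N[S] →
    let (u , u∈S , u∼v) = ∈-closedNbhd⁻ v∈N[S]
    in x∈∁p⇒x∉p (S⊆ u∈S) (∈-closedNbhd⁺ v∈J (∼-sym u∼v))

  isDominating≡ : ∀ S → isDominating G S ≡ (∣ ∁ (closedNbhd G S) ∣ ≡ᵇ 0)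
  isDominating≡ S = does-⇔ (mk⇔ to from) (T? _) (T? _)
    where
      to : T (isDominating G S) → T (∣ ∁ (closedNbhd G S) ∣ ≡ᵇ 0)
      to dom = ℕ.≡⇒≡ᵇ _ 0 (Empty⇒∣p∣≡0 λ (v , v∈∁N) →
                 x∈∁p⇒x∉p v∈∁N (∈-tabulate⁺ (inClosedNbhd S) (allV⁻ (inClosedNbhd S) dom v)))
      from : T (∣ ∁ (closedNbhd G S) ∣ ≡ᵇ 0) → T (isDominating G S)
      from ∣∁N∣≡0 = allV⁺ (inClosedNbhd S) λ v →
        ∈-tabulate⁻ (inClosedNbhd S) (x∉∁p⇒x∈p (∣p∣≡0⇒x∉p (ℕ.≡ᵇ⇒≡ _ 0 ∣∁N∣≡0)))

  ∉closedNbhd⇒⊂∁openNbhd : ∀ {J v} → v ∉ closedNbhd G J → J ⊂ ∁ (openNbhd G v)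
  ∉closedNbhd⇒⊂∁openNbhd {J} {v} v∉N[J] =
      (λ u∈J → x∉p⇒x∈∁p λ u∈N[v] → v∉N[J] (∈-closedNbhd⁺ u∈J (∼-sym (inj₂ (∈-openNbhd⁻ u∈N[v])))))
    , v , x∉p⇒x∈∁p ∉-openNbhd , λ v∈J → v∉N[J] (∈-closedNbhd⁺ v∈J (inj₁ refl))

  closedNbhd-[]≔ : NoIsolated G → ∀ {S v} → openNbhd G v ⊆ S [ v ]≔ outside →
                   closedNbhd G (S [ v ]≔ inside) ≡ closedNbhd G (S [ v ]≔ outside)
  closedNbhd-[]≔ noIsolated {S} {v} N[v]⊆S₀ = ⊆-antisym shrink grow
    where
      grow : closedNbhd G (S [ v ]≔ outside) ⊆ closedNbhd G (S [ v ]≔ inside)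
      grow w∈N with ∈-closedNbhd⁻ w∈N
      ... | u , u∈S₀ , u∼w =
        ∈-closedNbhd⁺ (∈-[]≔-retoggle {S = S} (λ { refl → ∉-[]≔outside {S = S} u∈S₀ }) u∈S₀) u∼w
      shrink : closedNbhd G (S [ v ]≔ inside) ⊆ closedNbhd G (S [ v ]≔ outside)
      shrink w∈N with ∈-closedNbhd⁻ w∈N
      ... | u , u∈S₁ , u∼w with u Fin.≟ v
      ...   | no u≢v = ∈-closedNbhd⁺ (∈-[]≔-retoggle {S = S} u≢v u∈S₁) u∼w
      ...   | yes refl with u∼w
      ...     | inj₂ v-w = ∈-closedNbhd⁺ (N[v]⊆S₀ (∈-openNbhd⁺ v-w)) (inj₁ refl)
      -- v itself stays dominated through any of its neighbours, all of which lie in S [ v ]≔ outside.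
      ...     | inj₁ refl = let (t , v-t) = noIsolated v; v-t′ = Equivalence.from T-≡ v-t in
                            ∈-closedNbhd⁺ (N[v]⊆S₀ (∈-openNbhd⁺ v-t′)) (∼-sym (inj₂ v-t′))

  ∈-singleton : ∀ (v : Fin n) → v ∈ tabulate (λ w → ⌊ w Fin.≟ v ⌋)
  ∈-singleton v = ∈-tabulate⁺ (λ w → ⌊ w Fin.≟ v ⌋) (fromWitness refl)

  -- Two maxima of closed neighbourhoods cannot be adjacent, since each would precede the other.
  max-∉-broken : ∀ (ord : LinearOrder n) {v X} → IsMaxOfClosedNbhd G ord v → IsBrokenNbhd G ord X → v ∉ X
  max-∉-broken (r , r-inj) {v} v-max (v′ , v′-max , refl) v∈N[v′] =
    ∉-openNbhd (≡.subst (λ u → v ∈ openNbhd G u) (≡.sym v≡v′) v∈N[v′])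
    where
      v′-v : T (adj G v′ v)
      v′-v = ∈-openNbhd⁻ v∈N[v′]
      v≡v′ : v ≡ v′
      v≡v′ = r-inj (toℕ-injective (ℕ.≤-antisym
        (v′-max v (∈-closedNbhd⁺ (∈-singleton v′) (inj₂ v′-v)))
        (v-max v′ (∈-closedNbhd⁺ (∈-singleton v) (∼-sym (inj₂ v′-v))))))

  avoids-[]≔ : ∀ (ord : LinearOrder n) {𝒳 v} → All (IsBrokenNbhd G ord) 𝒳 → IsMaxOfClosedNbhd G ord v →
               ∀ S b b′ → avoids 𝒳 (S [ v ]≔ b) ≡ avoids 𝒳 (S [ v ]≔ b′)
  avoids-[]≔ ord [] v-max S b b′ = refl
  avoids-[]≔ ord {X ∷ 𝒳} (X-broken ∷ 𝒳-broken) v-max S b b′ =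
    ≡.cong₂ (λ p q → not p ∧ q) (⌊⊆?⌋-[]≔ {S = S} (max-∉-broken ord v-max X-broken))
                                (avoids-[]≔ ord 𝒳-broken v-max S b b′)

minDegree≤degree : ∀ {m} (G : Graph (suc m)) v → minDegree G ≤ degree G v
minDegree≤degree G v = go (allFin _) (∈-allFin v)
  where
    go : ∀ vs → v ∈ₗ vs → foldr (λ u d → degree G u ⊓ d) (degree G Fin.zero) vs ≤ degree G v
    go (u ∷ vs) (here refl) = ℕ.m⊓n≤m (degree G u) _
    go (u ∷ vs) (there v∈vs) = ℕ.≤-trans (ℕ.m⊓n≤n (degree G u) _) (go vs v∈vs)

∣J∣>n∸δ⇒dominating : ∀ {m} (G : Graph (suc m)) J → ¬ T (∣ J ∣ ≤ᵇ suc m ∸ minDegree G) →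
                     ∣ ∁ (closedNbhd G J) ∣ ≡ 0
∣J∣>n∸δ⇒dominating {m} G J large = Empty⇒∣p∣≡0 λ (v , v∈∁N[J]) → large (ℕ.≤⇒≤ᵇ (begin
    ∣ J ∣                       <⟨ p⊂q⇒∣p∣<∣q∣ (∉closedNbhd⇒⊂∁openNbhd {J} (x∈∁p⇒x∉p v∈∁N[J])) ⟩
    ∣ ∁ (openNbhd G v) ∣        ≡⟨ ∣∁p∣≡n∸∣p∣ (openNbhd G v) ⟩
    suc m ∸ degree G v          ≤⟨ ℕ.∸-monoʳ-≤ (suc m) (minDegree≤degree G v) ⟩
    suc m ∸ minDegree G         ∎))
  where
    open Neighbourhoods G
    open ℕ.≤-Reasoning

module InclusionExclusion {c ℓ : Level} (R : CommutativeRing c ℓ) {n : ℕ} (G : Graph n)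
                          (x : CommutativeRing.Carrier R) where
  open CommutativeRing R renaming (refl to ≈-refl; sym to ≈-sym; trans to ≈-trans) hiding (zero)
  open InRing R
  open Sums R
  open Neighbourhoods G
  open import Relation.Binary.Reasoning.Setoid setoid

  sign : Subset n → Carrier
  sign J = pow (- 1#) ∣ J ∣

  sumSubsets≈∑ : ∀ P f → sumSubsets n P f ≈ ∑ n λ J → [ P J ]· f J
  sumSubsets≈∑ P f = sumL-filter P f (allSubsets n)

  domPoly≈∑dominating : domPoly G x ≈ ∑ n λ S → [ isDominating G S ]· pow x ∣ S ∣
  domPoly≈∑dominating = begin
    domPoly G x
      ≈⟨ sumTo-cong n (λ k → nat-length-filter _ (pow x k) (allSubsets n)) ⟩
    sumTo n (λ k → ∑ n λ S → [ isDominating G S ∧ (∣ S ∣ ≡ᵇ k) ]· pow x k)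
      ≈⟨ sumTo-sumL n _ (allSubsets n) ⟩
    ∑ n (λ S → sumTo n λ k → [ isDominating G S ∧ (∣ S ∣ ≡ᵇ k) ]· pow x k)
      ≈⟨ ∑-cong n select ⟩
    ∑ n (λ S → [ isDominating G S ]· pow x ∣ S ∣) ∎
    where
      select : ∀ S → sumTo n (λ k → [ isDominating G S ∧ (∣ S ∣ ≡ᵇ k) ]· pow x k)
                     ≈ [ isDominating G S ]· pow x ∣ S ∣
      select S with isDominating G S
      ... | true = sumTo-select n ∣ S ∣ (pow x) (∣p∣≤n S)
      ... | false = sumTo-zero n

  term₁-expand : ∀ J → term₁ G x J ≈ ∑ n λ S → [ does (S ⊆? ∁ (closedNbhd G J)) ]· (sign J * pow x ∣ S ∣)
  term₁-expand J = begin
    sign J * pow (x + 1#) (n ∸ ∣ closedNbhd G J ∣)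
      ≡⟨ ≡.cong (λ k → sign J * pow (x + 1#) k) (∣∁p∣≡n∸∣p∣ (closedNbhd G J)) ⟨
    sign J * pow (x + 1#) ∣ ∁ (closedNbhd G J) ∣
      ≈⟨ *-congˡ (binomial n x _) ⟩
    sign J * ∑ n (λ S → [ does (S ⊆? ∁ (closedNbhd G J)) ]· pow x ∣ S ∣)
      ≈⟨ *-distribˡ-sumL (sign J) _ (allSubsets n) ⟩
    ∑ n (λ S → sign J * [ does (S ⊆? ∁ (closedNbhd G J)) ]· pow x ∣ S ∣)
      ≈⟨ ∑-cong n (λ S → *-[]· (sign J) _ _) ⟩
    ∑ n (λ S → [ does (S ⊆? ∁ (closedNbhd G J)) ]· (sign J * pow x ∣ S ∣)) ∎

  ∑-sign-undominated : ∀ S → ∑ n (λ J → [ does (J ⊆? ∁ (closedNbhd G S)) ]· sign J) ≈ [ isDominating G S ]· 1#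
  ∑-sign-undominated S = begin
    ∑ n (λ J → [ does (J ⊆? ∁ (closedNbhd G S)) ]· sign J)   ≈⟨ binomial n (- 1#) _ ⟨
    pow (- 1# + 1#) ∣ ∁ (closedNbhd G S) ∣                   ≈⟨ pow-0 ∣ ∁ (closedNbhd G S) ∣ ⟩
    [ ∣ ∁ (closedNbhd G S) ∣ ≡ᵇ 0 ]· 1#                      ≡⟨ ≡.cong ([_]· 1#) (isDominating≡ S) ⟨
    [ isDominating G S ]· 1#                                 ∎

  domPoly≈∑term₁ : domPoly G x ≈ ∑ n (term₁ G x)
  domPoly≈∑term₁ = ≈-sym (begin
    ∑ n (term₁ G x)
      ≈⟨ ∑-cong n term₁-expand ⟩
    ∑ n (λ J → ∑ n λ S → [ does (S ⊆? ∁ (closedNbhd G J)) ]· (sign J * pow x ∣ S ∣))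
      ≈⟨ sumL-swap _ (allSubsets n) (allSubsets n) ⟩
    ∑ n (λ S → ∑ n λ J → [ does (S ⊆? ∁ (closedNbhd G J)) ]· (sign J * pow x ∣ S ∣))
      ≈⟨ ∑-cong n (λ S → ∑-cong n (λ J → flip S J)) ⟩
    ∑ n (λ S → ∑ n λ J → ([ does (J ⊆? ∁ (closedNbhd G S)) ]· sign J) * pow x ∣ S ∣)
      ≈⟨ ∑-cong n (λ S → *-distribʳ-sumL (pow x ∣ S ∣) _ (allSubsets n)) ⟨
    ∑ n (λ S → ∑ n (λ J → [ does (J ⊆? ∁ (closedNbhd G S)) ]· sign J) * pow x ∣ S ∣)
      ≈⟨ ∑-cong n (λ S → *-congʳ (∑-sign-undominated S)) ⟩
    ∑ n (λ S → ([ isDominating G S ]· 1#) * pow x ∣ S ∣)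
      ≈⟨ ∑-cong n (λ S → ≈-trans ([]·-* _ 1# _) ([]·-cong _ (*-identityˡ _))) ⟩
    ∑ n (λ S → [ isDominating G S ]· pow x ∣ S ∣)
      ≈⟨ domPoly≈∑dominating ⟨
    domPoly G x ∎)
    where
      flip : ∀ S J → [ does (S ⊆? ∁ (closedNbhd G J)) ]· (sign J * pow x ∣ S ∣)
                     ≈ ([ does (J ⊆? ∁ (closedNbhd G S)) ]· sign J) * pow x ∣ S ∣
      flip S J = begin
        [ does (S ⊆? ∁ (closedNbhd G J)) ]· (sign J * pow x ∣ S ∣)
          ≡⟨ ≡.cong ([_]· (sign J * pow x ∣ S ∣))
                    (does-⇔ (mk⇔ ⊆∁closedNbhd-sym ⊆∁closedNbhd-sym) (S ⊆? _) (J ⊆? _)) ⟩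
        [ does (J ⊆? ∁ (closedNbhd G S)) ]· (sign J * pow x ∣ S ∣)
          ≈⟨ []·-* _ (sign J) _ ⟨
        ([ does (J ⊆? ∁ (closedNbhd G S)) ]· sign J) * pow x ∣ S ∣ ∎

module DominationPolynomial {c ℓ : Level} (R : CommutativeRing c ℓ) {m : ℕ} (G : Graph (suc m))
                            (x : CommutativeRing.Carrier R) where
  open CommutativeRing R renaming (refl to ≈-refl; sym to ≈-sym; trans to ≈-trans) hiding (zero)
  open InRing R
  open Sums R
  open Neighbourhoods G
  open InclusionExclusion R G x public
  open import Relation.Binary.Reasoning.Setoid setoid

  small : Subset (suc m) → Bool
  small J = ∣ J ∣ ≤ᵇ (suc m ∸ minDegree G)

  ∑term₂≈∑term₁ : ∑ (suc m) (term₂ G x) ≈ ∑ (suc m) (term₁ G x)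
  ∑term₂≈∑term₁ = begin
    ∑ (suc m) (term₂ G x)                                   ≈⟨ ∑-cong (suc m) (λ J → distribˡ (sign J) _ _) ⟩
    ∑ (suc m) (λ J → term₁ G x J + sign J * - 1#)           ≈⟨ sumL-+ _ _ (allSubsets (suc m)) ⟩
    ∑ (suc m) (term₁ G x) + ∑ (suc m) (λ J → sign J * - 1#)
      ≈⟨ +-congˡ (*-distribʳ-sumL (- 1#) sign (allSubsets (suc m))) ⟨
    ∑ (suc m) (term₁ G x) + ∑ (suc m) sign * - 1#           ≈⟨ +-congˡ (*-congʳ (alternating-sum m)) ⟩
    ∑ (suc m) (term₁ G x) + 0# * - 1#                       ≈⟨ +-congˡ (zeroˡ (- 1#)) ⟩
    ∑ (suc m) (term₁ G x) + 0#                              ≈⟨ +-identityʳ _ ⟩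
    ∑ (suc m) (term₁ G x)                                   ∎

  term₂-large≈0 : ∀ J → ¬ T (small J) → term₂ G x J ≈ 0#
  term₂-large≈0 J large = begin
    sign J * (pow (x + 1#) (suc m ∸ ∣ closedNbhd G J ∣) - 1#)
      ≡⟨ ≡.cong (λ k → sign J * (pow (x + 1#) k - 1#)) n∸∣N[J]∣≡0 ⟩
    sign J * (1# - 1#)                                      ≈⟨ *-congˡ (-‿inverseʳ 1#) ⟩
    sign J * 0#                                             ≈⟨ zeroʳ (sign J) ⟩
    0#                                                      ∎
    where
      n∸∣N[J]∣≡0 : suc m ∸ ∣ closedNbhd G J ∣ ≡ 0
      n∸∣N[J]∣≡0 = ≡.trans (≡.sym (∣∁p∣≡n∸∣p∣ (closedNbhd G J))) (∣J∣>n∸δ⇒dominating G J large)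

  module _ (noIsolated : NoIsolated G) where

    signed-toggle-cancel : ∀ (Q : Subset (suc m) → Carrier) {S v} → openNbhd G v ⊆ S [ v ]≔ outside →
      sign (S [ v ]≔ outside) * Q (closedNbhd G (S [ v ]≔ outside))
        + sign (S [ v ]≔ inside) * Q (closedNbhd G (S [ v ]≔ inside)) ≈ 0#
    signed-toggle-cancel Q {S} {v} N[v]⊆S₀ rewrite ∣[]≔inside∣ S v | closedNbhd-[]≔ noIsolated {S} {v} N[v]⊆S₀ =
      ≈-trans (+-congˡ (*-assoc (- 1#) _ _)) (x+-1*x≈0 _)

    ∑-avoiding : ∀ ord {𝒳} → All (IsBrokenNbhd G ord) 𝒳 → (Q : Subset (suc m) → Carrier) →
      ∑ (suc m) (λ J → [ avoids 𝒳 J ]· (sign J * Q (closedNbhd G J)))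
        ≈ ∑ (suc m) (λ J → sign J * Q (closedNbhd G J))
    ∑-avoiding ord [] Q = ≈-refl
    ∑-avoiding ord {X ∷ 𝒳} ((v , v-max , refl) ∷ 𝒳-broken) Q = begin
      ∑ (suc m) (λ J → [ not ⌊ X ⊆? J ⌋ ∧ avoids 𝒳 J ]· h J)         ≈⟨ +-identityʳ _ ⟨
      ∑ (suc m) (λ J → [ not ⌊ X ⊆? J ⌋ ∧ avoids 𝒳 J ]· h J) + 0#    ≈⟨ +-congˡ ∑-containing-X≈0 ⟨
      ∑ (suc m) (λ J → [ not ⌊ X ⊆? J ⌋ ∧ avoids 𝒳 J ]· h J)
        + ∑ (suc m) (λ J → [ ⌊ X ⊆? J ⌋ ∧ avoids 𝒳 J ]· h J)
        ≈⟨ sumL-+ _ _ (allSubsets (suc m)) ⟨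
      ∑ (suc m) (λ J → [ not ⌊ X ⊆? J ⌋ ∧ avoids 𝒳 J ]· h J + [ ⌊ X ⊆? J ⌋ ∧ avoids 𝒳 J ]· h J)
        ≈⟨ ∑-cong (suc m) (λ J → []·-split ⌊ X ⊆? J ⌋ (avoids 𝒳 J) (h J)) ⟩
      ∑ (suc m) (λ J → [ avoids 𝒳 J ]· h J)                          ≈⟨ ∑-avoiding ord 𝒳-broken Q ⟩
      ∑ (suc m) h                                                   ∎
      where
        h : Subset (suc m) → Carrier
        h J = sign J * Q (closedNbhd G J)
        contains-X : ∀ {J} → T (⌊ X ⊆? J ⌋ ∧ avoids 𝒳 J) → X ⊆ J
        contains-X {J} t = toWitness {a? = X ⊆? J} (proj₁ (Equivalence.to T-∧ t))
        ∑-containing-X≈0 : ∑ (suc m) (λ J → [ ⌊ X ⊆? J ⌋ ∧ avoids 𝒳 J ]· h J) ≈ 0#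
        ∑-containing-X≈0 = toggle-cancel (suc m) v _ λ S → []·-cancel
          (≡.cong₂ _∧_ (⌊⊆?⌋-[]≔ {S = S} ∉-openNbhd) (avoids-[]≔ ord 𝒳-broken v-max S outside inside))
          (λ t → signed-toggle-cancel Q (⊆-[]≔-retoggle {S = S} ∉-openNbhd (contains-X t)))

  domPoly≈∑all-term₁ : domPoly G x ≈ sumSubsets (suc m) (λ _ → true) (term₁ G x)
  domPoly≈∑all-term₁ = ≈-trans domPoly≈∑term₁ (≈-sym (sumSubsets≈∑ _ (term₁ G x)))

  domPoly≈∑term₂ : domPoly G x ≈ sumSubsets (suc m) small (term₂ G x)
  domPoly≈∑term₂ = ≈-trans domPoly≈∑term₁ (≈-sym (begin
    sumSubsets (suc m) small (term₂ G x)           ≈⟨ sumSubsets≈∑ small (term₂ G x) ⟩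
    ∑ (suc m) (λ J → [ small J ]· term₂ G x J)     ≈⟨ ∑-cong (suc m) (λ J → []·-absorb _ (term₂-large≈0 J)) ⟩
    ∑ (suc m) (term₂ G x)                          ≈⟨ ∑term₂≈∑term₁ ⟩
    ∑ (suc m) (term₁ G x)                          ∎))

  domPoly≈∑avoiding-term₁ : NoIsolated G → ∀ ord {𝒳} → All (IsBrokenNbhd G ord) 𝒳 →
                            domPoly G x ≈ sumSubsets (suc m) (avoids 𝒳) (term₁ G x)
  domPoly≈∑avoiding-term₁ noIsolated ord 𝒳-broken = ≈-trans domPoly≈∑term₁ (≈-sym (≈-trans
    (sumSubsets≈∑ _ (term₁ G x))
    (∑-avoiding noIsolated ord 𝒳-broken (λ N → pow (x + 1#) (suc m ∸ ∣ N ∣)))))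

  domPoly≈∑avoiding-term₂ : NoIsolated G → ∀ ord {𝒳} → All (IsBrokenNbhd G ord) 𝒳 →
                            domPoly G x ≈ sumSubsets (suc m) (λ J → small J ∧ avoids 𝒳 J) (term₂ G x)
  domPoly≈∑avoiding-term₂ noIsolated ord {𝒳} 𝒳-broken = ≈-trans domPoly≈∑term₁ (≈-sym (begin
    sumSubsets (suc m) (λ J → small J ∧ avoids 𝒳 J) (term₂ G x)
      ≈⟨ sumSubsets≈∑ _ (term₂ G x) ⟩
    ∑ (suc m) (λ J → [ small J ∧ avoids 𝒳 J ]· term₂ G x J)
      ≈⟨ ∑-cong (suc m) (λ J → []·-∧-absorb (avoids 𝒳 J) _ (term₂-large≈0 J)) ⟩
    ∑ (suc m) (λ J → [ avoids 𝒳 J ]· term₂ G x J)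
      ≈⟨ ∑-avoiding noIsolated ord 𝒳-broken (λ N → pow (x + 1#) (suc m ∸ ∣ N ∣) - 1#) ⟩
    ∑ (suc m) (term₂ G x)
      ≈⟨ ∑term₂≈∑term₁ ⟩
    ∑ (suc m) (term₁ G x) ∎))

theorem6 : ∀ {c ℓ} (m : ℕ) (G : Graph (suc m)) (R : CommutativeRing c ℓ)
  (x : CommutativeRing.Carrier R) →
  let open CommutativeRing R using (_≈_)
      open InRing R
      n = suc m
      small = λ (J : Subset n) → ∣ J ∣ ≤ᵇ (n ∸ minDegree G)
  in (domPoly G x ≈ sumSubsets n (λ _ → true) (term₁ G x))
     × (domPoly G x ≈ sumSubsets n small (term₂ G x))
     × (NoIsolated G → (ord : LinearOrder n) (𝒳 : List (Subset n)) →
          All (IsBrokenNbhd G ord) 𝒳 →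
          (domPoly G x ≈ sumSubsets n (avoids 𝒳) (term₁ G x))
          × (domPoly G x ≈ sumSubsets n (λ J → small J ∧ avoids 𝒳 J) (term₂ G x)))
theorem6 m G R x =
    domPoly≈∑all-term₁
  , domPoly≈∑term₂
  , λ noIsolated ord 𝒳 𝒳-broken →
      domPoly≈∑avoiding-term₁ noIsolated ord 𝒳-broken , domPoly≈∑avoiding-term₂ noIsolated ord 𝒳-broken
  where open DominationPolynomial R G x
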